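{- Let $A_1,\dots,A_m$ be a weak $(n,m)$-AMD code in a finite abelian group $G$ of order $n$. Then the code is R-optimal if and only if the quantity $e_\delta$ takes the same value for all $\delta\in G^*$.
   Context: $G$ is a finite abelian group of order $n$, written additively, and $G^*=G\setminus\{0\}$. A weak $(n,m)$-AMD code is a collection of pairwise disjoint nonempty subsets $A_1,\dots,A_m$ of $G$; write $k_i=|A_i|$ and $T=\sum_{i=1}^m k_i$. For $\delta\in G^*$ and $1\le i\le m$ let $N_i(\delta)=|\{(a_i,a_j): a_i\in A_i,\ a_j\in A_j \text{ for some } j\neq i,\ a_i-a_j=\delta\}|$. Define $e_\delta=\frac1m\sum_{i=1}^m \frac{1}{k_i}N_i(\delta)$ (the probability that an adversary choosing $\delta$ succeeds when a source $i$ is chosen uniformly and then $g\in A_i$ uniformly, success meaning $g+\delta\in A_j$ for some $j\ne i$). The code is called R-optimal if $\max_{\delta\in G^*} e_\delta=\frac{(m-1)T}{m(n-1)}$ (this value is always a lower bound for $\max_{\delta\in G^*} e_\delta$, the "R-bound"). -}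

module Defs where

open import Data.Nat as ℕ using (ℕ; zero; suc; _∸_)
open import Data.Integer using (+_)
open import Data.Fin using (Fin; _≟_)
open import Data.Fin.Subset using (Subset; _∈_; ∣_∣; Nonempty)
open import Data.Fin.Subset.Properties using (_∈?_)
open import Data.Fin.Properties using (any?)
open import Data.Product using (_×_; ∃; _,_)
open import Data.Rational as ℚ using (ℚ; 0ℚ; _/_)
open import Algebra.Core using (Op₁; Op₂)
open import Algebra.Structures using (IsAbelianGroup)
open import Relation.Binary.PropositionalEquality using (_≡_; _≢_)
open import Relation.Nullary using (Dec; yes; no; ¬?)
open import Relation.Nullary.Decidable using (_×-dec_)
import Data.Empty

-- A finite abelian group of order n, presented (up to isomorphism) on the
-- carrier Fin n, written additively.
record FinAbGroup (n : ℕ) : Set where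
  field
    _⊕_ : Op₂ (Fin n)
    0g  : Fin n
    ⊖_  : Op₁ (Fin n)
    isAbelianGroup : IsAbelianGroup _≡_ _⊕_ 0g ⊖_

count : ∀ {k} {P : Fin k → Set} → ((x : Fin k) → Dec (P x)) → ℕ
count {zero} P? = 0
count {suc k} P? with P? Fin.zero
... | yes _ = suc (count (λ x → P? (Fin.suc x)))
... | no  _ = count (λ x → P? (Fin.suc x))

sumℕ : ∀ {k} → (Fin k → ℕ) → ℕ
sumℕ {zero} f = 0
sumℕ {suc k} f = f Fin.zero ℕ.+ sumℕ (λ x → f (Fin.suc x))

sumℚ : ∀ {k} → (Fin k → ℚ) → ℚ
sumℚ {zero} f = 0ℚ
sumℚ {suc k} f = f Fin.zero ℚ.+ sumℚ (λ x → f (Fin.suc x))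

-- a / d as a rational; the value for d = 0 is a dummy (never used under
-- the hypotheses of the theorem, where all denominators are nonzero)
frac : ℕ → ℕ → ℚ
frac a zero = 0ℚ
frac a (suc d) = (+ a) / suc d

record IsWeakAMD {n m : ℕ} (A : Fin m → Subset n) : Set where
  field
    nonempty : ∀ i → Nonempty (A i)
    disjoint : ∀ i j (g : Fin n) → i ≢ j → g ∈ A i → g ∈ A j → Data.Empty.⊥

module AMD {n : ℕ} (G : FinAbGroup n) {m : ℕ} (A : Fin m → Subset n) where
  open FinAbGroup G

  k : Fin m → ℕ
  k i = ∣ A i ∣

  T : ℕ
  T = sumℕ k

  N : Fin m → Fin n → ℕ
  N i δ = sumℕ λ a → count {P = λ b → (a ∈ A i) × (∃ λ j → (j ≢ i) × (b ∈ A j)) × (a ⊕ (⊖ b) ≡ δ)}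
            (λ b → (a ∈? A i) ×-dec (any? (λ j → ¬? (j ≟ i) ×-dec (b ∈? A j)) ×-dec (a ⊕ (⊖ b) ≟ δ)))

  e : Fin n → ℚ
  e δ = frac 1 m ℚ.* sumℚ (λ i → frac (N i δ) (k i))

  Rbound : ℚ
  Rbound = frac ((m ∸ 1) ℕ.* T) (m ℕ.* (n ∸ 1))

  -- R-optimal: max over δ ∈ G* of e_δ equals the R-bound
  ROptimal : Set
  ROptimal = (∀ δ → δ ≢ 0g → e δ ℚ.≤ Rbound) × (∃ λ δ → (δ ≢ 0g) × (e δ ≡ Rbound))

module Submission where

-- Counting the pairs (a , b) with a in A_i and b in some other A_j
-- according to their difference a - b gives  Σ_δ N_i(δ) = k_i (T - k_i),
-- and no such difference is 0 because the A_j are disjoint.  Hence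
-- e_0 = 0 and  Σ_δ e_δ = (m-1) T / m = (n-1) R,  where R is the R-bound:
-- the n-1 values e_δ (δ ≠ 0) have average exactly R.  A finite family of
-- rationals with average R is bounded by R and attains it iff it is
-- constant, which is the theorem.

open import Defs
open import Data.Nat using (ℕ; zero; suc; _+_; _*_; _∸_; _≤_; _<_; s≤s; z≤n)
import Data.Nat.Properties as ℕP
open import Data.Integer as ℤ using ()
import Data.Integer.Properties as ℤP
open import Data.Fin using (Fin; _≟_; punchIn; punchOut) renaming (zero to fzero; suc to fsuc)
open import Data.Fin.Properties using (any?; suc-injective; punchInᵢ≢i; punchIn-punchOut)
open import Data.Fin.Subset using (Subset; _∈_; ∣_∣; inside; outside)
open import Data.Fin.Subset.Properties using (_∈?_)
open import Data.Vec.Base using ([]; _∷_; there)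
open import Data.Vec.Functional using (removeAt)
open import Data.Rational as ℚ using (ℚ; 0ℚ; 1ℚ; toℚᵘ)
import Data.Rational.Properties as ℚP
open import Data.Rational.Solver using (module +-*-Solver)
open import Data.Rational.Unnormalised as ℚᵘ using (mkℚᵘ; *≡*)
import Data.Rational.Unnormalised.Properties as ℚᵘP
open import Data.Product using (_×_; ∃; _,_)
open import Data.Empty using (⊥-elim)
open import Level using (0ℓ)
open import Function.Bundles using (_⇔_; mk⇔; Equivalence)
open import Algebra.Bundles using (CommutativeRing; Group)
open import Algebra.Structures using (IsAbelianGroup)
import Algebra.Properties.Group as GroupProperties
import Algebra.Properties.Semiring.Sum as SemiringSum
open import Relation.Binary.PropositionalEquality
open import Relation.Nullary using (Dec; yes; no; ¬?; ¬_)
open import Relation.Nullary.Decidable using (_×-dec_)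

module ℕ∑ = SemiringSum ℕP.+-*-semiring
module ℚ∑ = SemiringSum (CommutativeRing.semiring ℚP.+-*-commutativeRing)
open ℕ∑ using () renaming (sum to ∑ℕ)
open ℚ∑ using () renaming (sum to ∑ℚ)

sumℕ≡∑ℕ : ∀ {k} (f : Fin k → ℕ) → sumℕ f ≡ ∑ℕ f
sumℕ≡∑ℕ {zero}  f = refl
sumℕ≡∑ℕ {suc k} f = cong (f fzero +_) (sumℕ≡∑ℕ (λ x → f (fsuc x)))

sumℚ≡∑ℚ : ∀ {k} (f : Fin k → ℚ) → sumℚ f ≡ ∑ℚ f
sumℚ≡∑ℚ {zero}  f = refl
sumℚ≡∑ℚ {suc k} f = cong (f fzero ℚ.+_) (sumℚ≡∑ℚ (λ x → f (fsuc x)))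

∑ℕ-zero : ∀ {k} (f : Fin k → ℕ) → (∀ x → f x ≡ 0) → ∑ℕ f ≡ 0
∑ℕ-zero {k} f f≡0 = trans (ℕ∑.sum-cong-≗ f≡0) (ℕ∑.sum-replicate-zero k)

∑ℕ-const : ∀ k c → ∑ℕ {k} (λ _ → c) ≡ k * c
∑ℕ-const zero    c = refl
∑ℕ-const (suc k) c = cong (c +_) (∑ℕ-const k c)

𝟙 : ∀ {p} {P : Set p} → Dec P → ℕ
𝟙 (yes _) = 1
𝟙 (no _)  = 0

𝟙-yes : ∀ {p} {P : Set p} → P → (d : Dec P) → 𝟙 d ≡ 1
𝟙-yes _ (yes _) = refl
𝟙-yes x (no ¬x) = ⊥-elim (¬x x)

𝟙-no : ∀ {p} {P : Set p} → ¬ P → (d : Dec P) → 𝟙 d ≡ 0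
𝟙-no ¬x (yes x) = ⊥-elim (¬x x)
𝟙-no _  (no _)  = refl

𝟙-cong : ∀ {p q} {P : Set p} {Q : Set q} → (P → Q) → (Q → P) →
         (d : Dec P) (d′ : Dec Q) → 𝟙 d ≡ 𝟙 d′
𝟙-cong P→Q _   (yes x) d′ = sym (𝟙-yes (P→Q x) d′)
𝟙-cong _   Q→P (no ¬x) d′ = sym (𝟙-no (λ y → ¬x (Q→P y)) d′)

𝟙-× : ∀ {p q} {P : Set p} {Q : Set q} (d : Dec P) (d′ : Dec Q) →
      𝟙 (d ×-dec d′) ≡ 𝟙 d * 𝟙 d′
𝟙-× (yes x) (yes y) = refl
𝟙-× (yes x) (no ¬y) = refl
𝟙-× (no ¬x) d′      = refl

count≡∑ : ∀ {k} {P : Fin k → Set} (P? : ∀ x → Dec (P x)) →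
          count P? ≡ ∑ℕ (λ x → 𝟙 (P? x))
count≡∑ {zero}  P? = refl
count≡∑ {suc k} P? with P? fzero
... | yes _ = cong suc (count≡∑ (λ x → P? (fsuc x)))
... | no  _ = count≡∑ (λ x → P? (fsuc x))

card≡∑ : ∀ {k} (p : Subset k) → ∣ p ∣ ≡ ∑ℕ (λ x → 𝟙 (x ∈? p))
card≡∑ []           = refl
card≡∑ (inside ∷ p) = cong suc (trans (card≡∑ p) (ℕ∑.sum-cong-≗ (λ x →
  𝟙-cong there (λ { (there x∈p) → x∈p }) (x ∈? p) (fsuc x ∈? (inside ∷ p)))))
card≡∑ (outside ∷ p) = trans (card≡∑ p) (ℕ∑.sum-cong-≗ (λ x →
  𝟙-cong there (λ { (there x∈p) → x∈p }) (x ∈? p) (fsuc x ∈? (outside ∷ p))))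

any≡∑ : ∀ {k} {P : Fin k → Set} (P? : ∀ x → Dec (P x)) →
        (∀ x y → P x → P y → x ≡ y) → 𝟙 (any? P?) ≡ ∑ℕ (λ x → 𝟙 (P? x))
any≡∑ {zero}  P? _ = 𝟙-no (λ { (() , _) }) (any? P?)
any≡∑ {suc k} {P} P? unique = by-first-point (P? fzero)
  where
  open ≡-Reasoning
  0≢suc : ∀ {x : Fin k} → fzero ≢ fsuc x
  0≢suc ()
  by-first-point : Dec (P fzero) → 𝟙 (any? P?) ≡ ∑ℕ (λ x → 𝟙 (P? x))
  by-first-point (yes p₀) = begin
    𝟙 (any? P?)                                   ≡⟨ 𝟙-yes (fzero , p₀) (any? P?) ⟩
    1 + 0                                         ≡⟨ cong₂ _+_ (𝟙-yes p₀ (P? fzero)) (∑ℕ-zero _ no-other-witness) ⟨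
    𝟙 (P? fzero) + ∑ℕ (λ x → 𝟙 (P? (fsuc x)))     ∎
    where
    no-other-witness : ∀ x → 𝟙 (P? (fsuc x)) ≡ 0
    no-other-witness x = 𝟙-no (λ px → 0≢suc (unique _ _ p₀ px)) (P? (fsuc x))
  by-first-point (no ¬p₀) = begin
    𝟙 (any? P?)                                   ≡⟨ 𝟙-cong (λ { (fzero , p) → ⊥-elim (¬p₀ p) ; (fsuc x , p) → x , p })
                                                           (λ { (x , p) → fsuc x , p }) (any? P?) (any? (λ x → P? (fsuc x))) ⟩
    𝟙 (any? (λ x → P? (fsuc x)))                  ≡⟨ any≡∑ (λ x → P? (fsuc x)) (λ x y px py → suc-injective (unique _ _ px py)) ⟩
    ∑ℕ (λ x → 𝟙 (P? (fsuc x)))                    ≡⟨ cong (_+ ∑ℕ (λ x → 𝟙 (P? (fsuc x)))) (𝟙-no ¬p₀ (P? fzero)) ⟨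
    𝟙 (P? fzero) + ∑ℕ (λ x → 𝟙 (P? (fsuc x)))     ∎

∑-point : ∀ {k} (x : Fin k) → ∑ℕ (λ y → 𝟙 (x ≟ y)) ≡ 1
∑-point {suc k} x = begin
  ∑ℕ (λ y → 𝟙 (x ≟ y))                          ≡⟨ ℕ∑.sum-remove {i = x} (λ y → 𝟙 (x ≟ y)) ⟩
  𝟙 (x ≟ x) + ∑ℕ (λ z → 𝟙 (x ≟ punchIn x z))    ≡⟨ cong₂ _+_ (𝟙-yes refl (x ≟ x)) (∑ℕ-zero _ no-other) ⟩
  1                                              ∎
  where
  open ≡-Reasoning
  no-other : ∀ z → 𝟙 (x ≟ punchIn x z) ≡ 0
  no-other z = 𝟙-no (λ x≡z′ → punchInᵢ≢i x z (sym x≡z′)) (x ≟ punchIn x z)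

term≤∑ℕ : ∀ {k} (f : Fin k → ℕ) x → f x ≤ ∑ℕ f
term≤∑ℕ {suc k} f x = subst (f x ≤_) (sym (ℕ∑.sum-remove {i = x} f)) (ℕP.m≤m+n (f x) _)

∑-punctured : ∀ {k} (x : Fin (suc k)) (f : Fin (suc k) → ℕ) →
              ∑ℕ (λ y → 𝟙 (¬? (y ≟ x)) * f y) ≡ ∑ℕ (removeAt f x)
∑-punctured x f = begin
  ∑ℕ (λ y → 𝟙 (¬? (y ≟ x)) * f y)
    ≡⟨ ℕ∑.sum-remove {i = x} (λ y → 𝟙 (¬? (y ≟ x)) * f y) ⟩
  𝟙 (¬? (x ≟ x)) * f x + ∑ℕ (λ z → 𝟙 (¬? (punchIn x z ≟ x)) * f (punchIn x z))
    ≡⟨ cong₂ _+_ (cong (_* f x) (𝟙-no (λ x≢x → x≢x refl) (¬? (x ≟ x)))) (ℕ∑.sum-cong-≗ others) ⟩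
  ∑ℕ (removeAt f x) ∎
  where
  open ≡-Reasoning
  others : ∀ z → 𝟙 (¬? (punchIn x z ≟ x)) * f (punchIn x z) ≡ f (punchIn x z)
  others z = trans (cong (_* f (punchIn x z)) (𝟙-yes (punchInᵢ≢i x z) (¬? (punchIn x z ≟ x))))
                   (ℕP.*-identityˡ (f (punchIn x z)))

-- Arithmetic of  frac a K = a / K.  The basic identities are checked on
-- unnormalised rationals; everything else follows by cancelling K.

ι : ℕ → ℚ
ι a = frac a 1

toℚᵘ-frac : ∀ a d → toℚᵘ (frac a (suc d)) ℚᵘ.≃ mkℚᵘ (ℤ.+ a) d
toℚᵘ-frac a d = ℚP.toℚᵘ-fromℚᵘ (mkℚᵘ (ℤ.+ a) d)

ι-+ : ∀ a b → ι (a + b) ≡ ι a ℚ.+ ι b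
ι-+ a b = ℚP.toℚᵘ-injective (begin
  toℚᵘ (ι (a + b))                        ≈⟨ toℚᵘ-frac (a + b) 0 ⟩
  mkℚᵘ (ℤ.+ (a + b)) 0                    ≈⟨ *≡* (cong (ℤ._* ℤ.+ 1) numerator) ⟩
  mkℚᵘ (ℤ.+ a) 0 ℚᵘ.+ mkℚᵘ (ℤ.+ b) 0      ≈⟨ ℚᵘP.+-cong (toℚᵘ-frac a 0) (toℚᵘ-frac b 0) ⟨
  toℚᵘ (ι a) ℚᵘ.+ toℚᵘ (ι b)              ≈⟨ ℚP.toℚᵘ-homo-+ (ι a) (ι b) ⟨
  toℚᵘ (ι a ℚ.+ ι b)                      ∎)
  where
  open ℚᵘP.≃-Reasoning
  numerator : ℤ.+ (a + b) ≡ ℤ.+ a ℤ.* ℤ.+ 1 ℤ.+ ℤ.+ b ℤ.* ℤ.+ 1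
  numerator = trans (ℤP.pos-+ a b) (sym (cong₂ ℤ._+_ (ℤP.*-identityʳ (ℤ.+ a)) (ℤP.*-identityʳ (ℤ.+ b))))

ι-* : ∀ a b → ι (a * b) ≡ ι a ℚ.* ι b
ι-* a b = ℚP.toℚᵘ-injective (begin
  toℚᵘ (ι (a * b))                        ≈⟨ toℚᵘ-frac (a * b) 0 ⟩
  mkℚᵘ (ℤ.+ (a * b)) 0                    ≈⟨ *≡* (cong (ℤ._* ℤ.+ 1) (ℤP.pos-* a b)) ⟩
  mkℚᵘ (ℤ.+ a) 0 ℚᵘ.* mkℚᵘ (ℤ.+ b) 0      ≈⟨ ℚᵘP.*-cong (toℚᵘ-frac a 0) (toℚᵘ-frac b 0) ⟨
  toℚᵘ (ι a) ℚᵘ.* toℚᵘ (ι b)              ≈⟨ ℚP.toℚᵘ-homo-* (ι a) (ι b) ⟨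
  toℚᵘ (ι a ℚ.* ι b)                      ∎)
  where open ℚᵘP.≃-Reasoning

frac-*-denominator : ∀ a {K} → 0 < K → frac a K ℚ.* ι K ≡ ι a
frac-*-denominator a {suc d} _ = ℚP.toℚᵘ-injective (begin
  toℚᵘ (frac a (suc d) ℚ.* ι (suc d))            ≈⟨ ℚP.toℚᵘ-homo-* (frac a (suc d)) (ι (suc d)) ⟩
  toℚᵘ (frac a (suc d)) ℚᵘ.* toℚᵘ (ι (suc d))    ≈⟨ ℚᵘP.*-cong (toℚᵘ-frac a d) (toℚᵘ-frac (suc d) 0) ⟩
  mkℚᵘ (ℤ.+ a) d ℚᵘ.* mkℚᵘ (ℤ.+ suc d) 0         ≈⟨ *≡* cross-multiplied ⟩
  mkℚᵘ (ℤ.+ a) 0                                 ≈⟨ toℚᵘ-frac a 0 ⟨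
  toℚᵘ (ι a)                                     ∎)
  where
  open ℚᵘP.≃-Reasoning
  cross-multiplied : ℤ.+ a ℤ.* ℤ.+ suc d ℤ.* ℤ.+ 1 ≡ ℤ.+ a ℤ.* ℤ.+ suc (d * 1)
  cross-multiplied = trans (ℤP.*-identityʳ _) (cong (λ t → ℤ.+ a ℤ.* ℤ.+ suc t) (sym (ℕP.*-identityʳ d)))

*-cancelʳ-ι : ∀ K {x y : ℚ} → 0 < K → x ℚ.* ι K ≡ y ℚ.* ι K → x ≡ y
*-cancelʳ-ι K {x} {y} K>0 eq = begin
  x                          ≡⟨ unit x ⟨
  x ℚ.* ι K ℚ.* frac 1 K     ≡⟨ cong (ℚ._* frac 1 K) eq ⟩
  y ℚ.* ι K ℚ.* frac 1 K     ≡⟨ unit y ⟩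
  y                          ∎
  where
  open ≡-Reasoning
  unit : ∀ z → z ℚ.* ι K ℚ.* frac 1 K ≡ z
  unit z = begin
    z ℚ.* ι K ℚ.* frac 1 K     ≡⟨ ℚP.*-assoc z (ι K) (frac 1 K) ⟩
    z ℚ.* (ι K ℚ.* frac 1 K)   ≡⟨ cong (z ℚ.*_) (trans (ℚP.*-comm (ι K) (frac 1 K)) (frac-*-denominator 1 K>0)) ⟩
    z ℚ.* 1ℚ                   ≡⟨ ℚP.*-identityʳ z ⟩
    z                          ∎

frac-zero : ∀ K → frac 0 K ≡ 0ℚ
frac-zero zero    = refl
frac-zero (suc d) = *-cancelʳ-ι (suc d) (s≤s z≤n)
  (trans (frac-*-denominator 0 {suc d} (s≤s z≤n)) (sym (ℚP.*-zeroˡ (ι (suc d)))))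

frac-+ : ∀ a b K → frac (a + b) K ≡ frac a K ℚ.+ frac b K
frac-+ a b zero    = refl
frac-+ a b (suc d) = *-cancelʳ-ι K (s≤s z≤n) (begin
  frac (a + b) K ℚ.* ι K                            ≡⟨ frac-*-denominator (a + b) (s≤s z≤n) ⟩
  ι (a + b)                                         ≡⟨ ι-+ a b ⟩
  ι a ℚ.+ ι b                                       ≡⟨ cong₂ ℚ._+_ (frac-*-denominator a (s≤s z≤n))
                                                                  (frac-*-denominator b (s≤s z≤n)) ⟨
  frac a K ℚ.* ι K ℚ.+ frac b K ℚ.* ι K             ≡⟨ ℚP.*-distribʳ-+ (ι K) (frac a K) (frac b K) ⟨
  (frac a K ℚ.+ frac b K) ℚ.* ι K                   ∎)
  where
  open ≡-Reasoning
  K : ℕ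
  K = suc d

frac-∑ : ∀ {k} K (f : Fin k → ℕ) → frac (∑ℕ f) K ≡ ∑ℚ (λ x → frac (f x) K)
frac-∑ {zero}  K f = frac-zero K
frac-∑ {suc k} K f = trans (frac-+ (f fzero) _ K) (cong (frac (f fzero) K ℚ.+_) (frac-∑ K (λ x → f (fsuc x))))

frac-cancel : ∀ {K} s → 0 < K → frac (K * s) K ≡ ι s
frac-cancel {K} s K>0 = *-cancelʳ-ι K K>0 (begin
  frac (K * s) K ℚ.* ι K    ≡⟨ frac-*-denominator (K * s) K>0 ⟩
  ι (K * s)                 ≡⟨ cong ι (ℕP.*-comm K s) ⟩
  ι (s * K)                 ≡⟨ ι-* s K ⟩
  ι s ℚ.* ι K               ∎)
  where open ≡-Reasoning

frac-rescale : ∀ {M P} X → 0 < M → 0 < P → frac 1 M ℚ.* ι X ≡ ι P ℚ.* frac X (M * P)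
frac-rescale {suc M} {suc P} X _ _ = *-cancelʳ-ι MP (s≤s z≤n) (begin
  u ℚ.* ι X ℚ.* ι MP             ≡⟨ cong (u ℚ.* ι X ℚ.*_) (ι-* (suc M) (suc P)) ⟩
  u ℚ.* ι X ℚ.* (ιM ℚ.* ιP)      ≡⟨ solve 4 (λ u x m p → u :* x :* (m :* p) := u :* m :* (p :* x)) refl u (ι X) ιM ιP ⟩
  u ℚ.* ιM ℚ.* (ιP ℚ.* ι X)      ≡⟨ cong (ℚ._* (ιP ℚ.* ι X)) (frac-*-denominator 1 {suc M} (s≤s z≤n)) ⟩
  1ℚ ℚ.* (ιP ℚ.* ι X)            ≡⟨ ℚP.*-identityˡ (ιP ℚ.* ι X) ⟩
  ιP ℚ.* ι X                     ≡⟨ cong (ιP ℚ.*_) (frac-*-denominator X {MP} (s≤s z≤n)) ⟨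
  ιP ℚ.* (frac X MP ℚ.* ι MP)    ≡⟨ ℚP.*-assoc ιP (frac X MP) (ι MP) ⟨
  ιP ℚ.* frac X MP ℚ.* ι MP      ∎)
  where
  open ≡-Reasoning
  open +-*-Solver
  MP : ℕ
  MP = suc M * suc P
  u ιM ιP : ℚ
  u  = frac 1 (suc M)
  ιM = ι (suc M)
  ιP = ι (suc P)

∑ℚ-const : ∀ k c → ∑ℚ {k} (λ _ → c) ≡ ι k ℚ.* c
∑ℚ-const zero    c = sym (ℚP.*-zeroˡ c)
∑ℚ-const (suc k) c = begin
  c ℚ.+ ∑ℚ {k} (λ _ → c)      ≡⟨ cong (c ℚ.+_) (∑ℚ-const k c) ⟩
  c ℚ.+ ι k ℚ.* c             ≡⟨ cong (ℚ._+ ι k ℚ.* c) (ℚP.*-identityˡ c) ⟨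
  1ℚ ℚ.* c ℚ.+ ι k ℚ.* c      ≡⟨ ℚP.*-distribʳ-+ c 1ℚ (ι k) ⟨
  (1ℚ ℚ.+ ι k) ℚ.* c          ≡⟨ cong (ℚ._* c) (ι-+ 1 k) ⟨
  ι (suc k) ℚ.* c             ∎
  where open ≡-Reasoning

∑ℚ-nonneg : ∀ {k} (f : Fin k → ℚ) → (∀ x → 0ℚ ℚ.≤ f x) → 0ℚ ℚ.≤ ∑ℚ f
∑ℚ-nonneg {zero}  f _   = ℚP.≤-refl
∑ℚ-nonneg {suc k} f f≥0 = ℚP.+-mono-≤ (f≥0 fzero) (∑ℚ-nonneg (λ x → f (fsuc x)) (λ x → f≥0 (fsuc x)))

∑ℚ-nonneg-zero : ∀ {k} (f : Fin (suc k) → ℚ) → (∀ x → 0ℚ ℚ.≤ f x) →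
                 ∑ℚ f ≡ 0ℚ → ∀ x → f x ≡ 0ℚ
∑ℚ-nonneg-zero f f≥0 ∑f≡0 x = ℚP.≤-antisym fx≤0 (f≥0 x)
  where
  open ℚP.≤-Reasoning
  fx≤0 : f x ℚ.≤ 0ℚ
  fx≤0 = begin
    f x                              ≡⟨ ℚP.+-identityʳ (f x) ⟨
    f x ℚ.+ 0ℚ                       ≤⟨ ℚP.+-monoʳ-≤ (f x) (∑ℚ-nonneg (removeAt f x) (λ z → f≥0 (punchIn x z))) ⟩
    f x ℚ.+ ∑ℚ (removeAt f x)        ≡⟨ ℚ∑.sum-remove {i = x} f ⟨
    ∑ℚ f                             ≡⟨ ∑f≡0 ⟩
    0ℚ                               ∎

module ℚGroup = GroupProperties ℚP.+-0-group

-- If no member exceeds the average R, every member equals R: the gaps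
-- R - g x are nonnegative and sum to 0.
bounded-by-average : ∀ {k} (g : Fin (suc k) → ℚ) R → ∑ℚ g ≡ ι (suc k) ℚ.* R →
                     (∀ x → g x ℚ.≤ R) → ∀ x → g x ≡ R
bounded-by-average {k} g R ∑g g≤R x =
  sym (ℚGroup.x∙y⁻¹≈ε⇒x≈y R (g x) (∑ℚ-nonneg-zero gap gap≥0 ∑gap≡0 x))
  where
  gap : Fin (suc k) → ℚ
  gap y = R ℚ.- g y
  gap≥0 : ∀ y → 0ℚ ℚ.≤ gap y
  gap≥0 y = subst (ℚ._≤ gap y) (ℚP.+-inverseʳ (g y)) (ℚP.+-monoˡ-≤ (ℚ.- g y) (g≤R y))
  ∑gap≡0 : ∑ℚ gap ≡ 0ℚ
  ∑gap≡0 = ℚGroup.identityˡ-unique (∑ℚ gap) (∑ℚ g) (begin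
    ∑ℚ gap ℚ.+ ∑ℚ g                  ≡⟨ ℚ∑.∑-distrib-+ gap g ⟨
    ∑ℚ (λ y → gap y ℚ.+ g y)         ≡⟨ ℚ∑.sum-cong-≗ (λ y → solve 2 (λ r s → (r :- s) :+ s := r) refl R (g y)) ⟩
    ∑ℚ {suc k} (λ _ → R)             ≡⟨ ∑ℚ-const (suc k) R ⟩
    ι (suc k) ℚ.* R                  ≡⟨ ∑g ⟨
    ∑ℚ g                             ∎)
    where
    open ≡-Reasoning
    open +-*-Solver

constant-is-average : ∀ {k} (g : Fin (suc k) → ℚ) R → ∑ℚ g ≡ ι (suc k) ℚ.* R →
                      (∀ x y → g x ≡ g y) → ∀ x → g x ≡ R
constant-is-average {k} g R ∑g g-const x = *-cancelʳ-ι (suc k) (s≤s z≤n) (begin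
  g x ℚ.* ι (suc k)            ≡⟨ ℚP.*-comm (g x) (ι (suc k)) ⟩
  ι (suc k) ℚ.* g x            ≡⟨ ∑ℚ-const (suc k) (g x) ⟨
  ∑ℚ {suc k} (λ _ → g x)       ≡⟨ ℚ∑.sum-cong-≗ (λ y → g-const x y) ⟩
  ∑ℚ g                         ≡⟨ ∑g ⟩
  ι (suc k) ℚ.* R              ≡⟨ ℚP.*-comm (ι (suc k)) R ⟩
  R ℚ.* ι (suc k)              ∎)
  where open ≡-Reasoning

average-principle : ∀ {k} (g : Fin (suc k) → ℚ) R → ∑ℚ g ≡ ι (suc k) ℚ.* R →
                    ((∀ x → g x ℚ.≤ R) × ∃ (λ x → g x ≡ R)) ⇔ (∀ x y → g x ≡ g y)
average-principle g R ∑g = mk⇔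
  (λ { (g≤R , _) x y → trans (bounded-by-average g R ∑g g≤R x) (sym (bounded-by-average g R ∑g g≤R y)) })
  (λ g-const → (λ x → ℚP.≤-reflexive (constant-is-average g R ∑g g-const x))
             , fzero , constant-is-average g R ∑g g-const fzero)

punctured-∀ : ∀ {k} {P : Fin (suc k) → Set} z → (∀ x → P (punchIn z x)) → ∀ δ → δ ≢ z → P δ
punctured-∀ {P = P} z P-in δ δ≢z = subst P (punchIn-punchOut (λ z≡δ → δ≢z (sym z≡δ))) (P-in _)

punctured-average : ∀ {k} (f : Fin (suc (suc k)) → ℚ) z R → f z ≡ 0ℚ →
                    ∑ℚ f ≡ ι (suc k) ℚ.* R →
                    ((∀ δ → δ ≢ z → f δ ℚ.≤ R) × ∃ (λ δ → δ ≢ z × f δ ≡ R))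
                    ⇔ (∀ δ δ′ → δ ≢ z → δ′ ≢ z → f δ ≡ f δ′)
punctured-average {k} f z R fz≡0 ∑f = mk⇔ bounded⇒constant constant⇒bounded
  where
  open ≡-Reasoning
  g : Fin (suc k) → ℚ
  g = removeAt f z
  ∑g : ∑ℚ g ≡ ι (suc k) ℚ.* R
  ∑g = begin
    ∑ℚ g               ≡⟨ ℚP.+-identityˡ (∑ℚ g) ⟨
    0ℚ ℚ.+ ∑ℚ g        ≡⟨ cong (ℚ._+ ∑ℚ g) fz≡0 ⟨
    f z ℚ.+ ∑ℚ g       ≡⟨ ℚ∑.sum-remove {i = z} f ⟨
    ∑ℚ f               ≡⟨ ∑f ⟩
    ι (suc k) ℚ.* R    ∎
  principle : ((∀ x → g x ℚ.≤ R) × ∃ (λ x → g x ≡ R)) ⇔ (∀ x y → g x ≡ g y)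
  principle = average-principle g R ∑g
  bounded⇒constant : ((∀ δ → δ ≢ z → f δ ℚ.≤ R) × ∃ (λ δ → δ ≢ z × f δ ≡ R)) →
                     ∀ δ δ′ → δ ≢ z → δ′ ≢ z → f δ ≡ f δ′
  bounded⇒constant (f≤R , δ₀ , δ₀≢z , fδ₀≡R) δ δ′ δ≢z δ′≢z =
    punctured-∀ {P = λ ε → f ε ≡ f δ′} z
      (λ x → punctured-∀ {P = λ ε → g x ≡ f ε} z (g-const x) δ′ δ′≢z) δ δ≢z
    where
    attained : ∃ λ x → g x ≡ R
    attained = punchOut (λ z≡δ₀ → δ₀≢z (sym z≡δ₀)) , trans (cong f (punchIn-punchOut _)) fδ₀≡R
    g-const : ∀ x y → g x ≡ g y
    g-const = Equivalence.to principle ((λ x → f≤R _ (punchInᵢ≢i z x)) , attained)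
  constant⇒bounded : (∀ δ δ′ → δ ≢ z → δ′ ≢ z → f δ ≡ f δ′) →
                     (∀ δ → δ ≢ z → f δ ℚ.≤ R) × ∃ (λ δ → δ ≢ z × f δ ≡ R)
  constant⇒bounded f-const = lift (Equivalence.from principle
    (λ x y → f-const _ _ (punchInᵢ≢i z x) (punchInᵢ≢i z y)))
    where
    lift : ((∀ x → g x ℚ.≤ R) × ∃ (λ x → g x ≡ R)) →
           (∀ δ → δ ≢ z → f δ ℚ.≤ R) × ∃ (λ δ → δ ≢ z × f δ ≡ R)
    lift (g≤R , x , gx≡R) = punctured-∀ z g≤R , punchIn z x , punchInᵢ≢i z x , gx≡R

-- Double counting for a weak AMD code.  The sources are indexed by
-- Fin (suc m′), i.e. m = m′ + 1 ≥ 1.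

module CodeCounting {n : ℕ} (G : FinAbGroup n) {m′ : ℕ} (A : Fin (suc m′) → Subset n)
                    (weak : IsWeakAMD A) where
  open FinAbGroup G
  open AMD G A
  open IsWeakAMD weak
  open ≡-Reasoning

  group : Group 0ℓ 0ℓ
  group = record { Carrier = Fin n ; _≈_ = _≡_ ; _∙_ = _⊕_ ; ε = 0g ; _⁻¹ = ⊖_
                 ; isGroup = IsAbelianGroup.isGroup isAbelianGroup }

  open GroupProperties group using (x∙y⁻¹≈ε⇒x≈y)

  inOthers? : ∀ i b → Dec (∃ λ j → (j ≢ i) × (b ∈ A j))
  inOthers? i b = any? (λ j → ¬? (j ≟ i) ×-dec (b ∈? A j))

  rest : Fin (suc m′) → ℕ
  rest i = ∑ℕ (removeAt k i)

  T≡k+rest : ∀ i → T ≡ k i + rest i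
  T≡k+rest i = trans (sumℕ≡∑ℕ k) (ℕ∑.sum-remove {i = i} k)

  k-pos : ∀ i → 0 < k i
  k-pos i with nonempty i
  ... | x , x∈Ai = subst₂ _≤_ (𝟙-yes x∈Ai (x ∈? A i)) (sym (card≡∑ (A i))) (term≤∑ℕ _ x)

  rest-total : ∑ℕ rest ≡ m′ * T
  rest-total = ℕP.+-cancelˡ-≡ T _ _ (begin
    T + ∑ℕ rest                    ≡⟨ cong (_+ ∑ℕ rest) (sumℕ≡∑ℕ k) ⟩
    ∑ℕ k + ∑ℕ rest                 ≡⟨ ℕ∑.∑-distrib-+ k rest ⟨
    ∑ℕ (λ i → k i + rest i)        ≡⟨ ℕ∑.sum-cong-≗ (λ i → sym (T≡k+rest i)) ⟩
    ∑ℕ {suc m′} (λ _ → T)          ≡⟨ ∑ℕ-const (suc m′) T ⟩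
    T + m′ * T                     ∎)

  -- By disjointness, the points lying in some other source number T - k_i.
  others-size : ∀ i → ∑ℕ (λ b → 𝟙 (inOthers? i b)) ≡ rest i
  others-size i = begin
    ∑ℕ (λ b → 𝟙 (inOthers? i b))
      ≡⟨ ℕ∑.sum-cong-≗ (λ b → any≡∑ (λ j → ¬? (j ≟ i) ×-dec (b ∈? A j)) (at-most-one b)) ⟩
    ∑ℕ (λ b → ∑ℕ (λ j → 𝟙 (¬? (j ≟ i) ×-dec (b ∈? A j))))
      ≡⟨ ℕ∑.sum-cong-≗ (λ b → ℕ∑.sum-cong-≗ (λ j → 𝟙-× (¬? (j ≟ i)) (b ∈? A j))) ⟩
    ∑ℕ (λ b → ∑ℕ (λ j → 𝟙 (¬? (j ≟ i)) * 𝟙 (b ∈? A j)))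
      ≡⟨ ℕ∑.∑-comm (λ b j → 𝟙 (¬? (j ≟ i)) * 𝟙 (b ∈? A j)) ⟩
    ∑ℕ (λ j → ∑ℕ (λ b → 𝟙 (¬? (j ≟ i)) * 𝟙 (b ∈? A j)))
      ≡⟨ ℕ∑.sum-cong-≗ (λ j → ℕ∑.*-distribˡ-sum (𝟙 (¬? (j ≟ i))) (λ b → 𝟙 (b ∈? A j))) ⟨
    ∑ℕ (λ j → 𝟙 (¬? (j ≟ i)) * ∑ℕ (λ b → 𝟙 (b ∈? A j)))
      ≡⟨ ℕ∑.sum-cong-≗ (λ j → cong (𝟙 (¬? (j ≟ i)) *_) (card≡∑ (A j))) ⟨
    ∑ℕ (λ j → 𝟙 (¬? (j ≟ i)) * k j)
      ≡⟨ ∑-punctured i k ⟩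
    rest i ∎
    where
    at-most-one : ∀ b j j′ → (j ≢ i) × (b ∈ A j) → (j′ ≢ i) × (b ∈ A j′) → j ≡ j′
    at-most-one b j j′ (_ , b∈Aj) (_ , b∈Aj′) with j ≟ j′
    ... | yes j≡j′ = j≡j′
    ... | no  j≢j′ = ⊥-elim (disjoint j j′ b j≢j′ b∈Aj b∈Aj′)

  pair? : ∀ i δ a b → Dec ((a ∈ A i) × (∃ λ j → (j ≢ i) × (b ∈ A j)) × (a ⊕ (⊖ b) ≡ δ))
  pair? i δ a b = (a ∈? A i) ×-dec (inOthers? i b ×-dec (a ⊕ (⊖ b) ≟ δ))

  N≡∑ : ∀ i δ → N i δ ≡ ∑ℕ (λ a → ∑ℕ (λ b → 𝟙 (pair? i δ a b)))
  N≡∑ i δ = trans (sumℕ≡∑ℕ (λ a → count (pair? i δ a))) (ℕ∑.sum-cong-≗ (λ a → count≡∑ (pair? i δ a)))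

  -- Each pair is counted for exactly one difference δ.
  pair-once : ∀ i a b → ∑ℕ (λ δ → 𝟙 (pair? i δ a b)) ≡ 𝟙 (a ∈? A i) * 𝟙 (inOthers? i b)
  pair-once i a b = begin
    ∑ℕ (λ δ → 𝟙 (pair? i δ a b))
      ≡⟨ ℕ∑.sum-cong-≗ (λ δ → begin
           𝟙 (pair? i δ a b)                           ≡⟨ 𝟙-× (a ∈? A i) (inOthers? i b ×-dec (a ⊕ (⊖ b) ≟ δ)) ⟩
           aᵢ * 𝟙 (inOthers? i b ×-dec (a ⊕ (⊖ b) ≟ δ)) ≡⟨ cong (aᵢ *_) (𝟙-× (inOthers? i b) (a ⊕ (⊖ b) ≟ δ)) ⟩
           aᵢ * (bₒ * 𝟙 (a ⊕ (⊖ b) ≟ δ))                ≡⟨ ℕP.*-assoc aᵢ bₒ _ ⟨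
           aᵢ * bₒ * 𝟙 (a ⊕ (⊖ b) ≟ δ)                  ∎) ⟩
    ∑ℕ (λ δ → aᵢ * bₒ * 𝟙 (a ⊕ (⊖ b) ≟ δ))
      ≡⟨ ℕ∑.*-distribˡ-sum (aᵢ * bₒ) (λ δ → 𝟙 (a ⊕ (⊖ b) ≟ δ)) ⟨
    aᵢ * bₒ * ∑ℕ (λ δ → 𝟙 (a ⊕ (⊖ b) ≟ δ))
      ≡⟨ cong (aᵢ * bₒ *_) (∑-point (a ⊕ (⊖ b))) ⟩
    aᵢ * bₒ * 1
      ≡⟨ ℕP.*-identityʳ _ ⟩
    aᵢ * bₒ ∎
    where
    aᵢ = 𝟙 (a ∈? A i)
    bₒ = 𝟙 (inOthers? i b)

  N-total : ∀ i → ∑ℕ (N i) ≡ k i * rest i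
  N-total i = begin
    ∑ℕ (N i)
      ≡⟨ ℕ∑.sum-cong-≗ (N≡∑ i) ⟩
    ∑ℕ (λ δ → ∑ℕ (λ a → ∑ℕ (λ b → 𝟙 (pair? i δ a b))))
      ≡⟨ ℕ∑.∑-comm (λ δ a → ∑ℕ (λ b → 𝟙 (pair? i δ a b))) ⟩
    ∑ℕ (λ a → ∑ℕ (λ δ → ∑ℕ (λ b → 𝟙 (pair? i δ a b))))
      ≡⟨ ℕ∑.sum-cong-≗ (λ a → ℕ∑.∑-comm (λ δ b → 𝟙 (pair? i δ a b))) ⟩
    ∑ℕ (λ a → ∑ℕ (λ b → ∑ℕ (λ δ → 𝟙 (pair? i δ a b))))
      ≡⟨ ℕ∑.sum-cong-≗ (λ a → ℕ∑.sum-cong-≗ (pair-once i a)) ⟩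
    ∑ℕ (λ a → ∑ℕ (λ b → 𝟙 (a ∈? A i) * 𝟙 (inOthers? i b)))
      ≡⟨ ℕ∑.sum-cong-≗ (λ a → ℕ∑.*-distribˡ-sum (𝟙 (a ∈? A i)) (λ b → 𝟙 (inOthers? i b))) ⟨
    ∑ℕ (λ a → 𝟙 (a ∈? A i) * ∑ℕ (λ b → 𝟙 (inOthers? i b)))
      ≡⟨ ℕ∑.sum-cong-≗ (λ a → cong (𝟙 (a ∈? A i) *_) (others-size i)) ⟩
    ∑ℕ (λ a → 𝟙 (a ∈? A i) * rest i)
      ≡⟨ ℕ∑.*-distribʳ-sum (rest i) (λ a → 𝟙 (a ∈? A i)) ⟨
    ∑ℕ (λ a → 𝟙 (a ∈? A i)) * rest i
      ≡⟨ cong (_* rest i) (card≡∑ (A i)) ⟨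
    k i * rest i ∎

  -- Disjointness: no counted pair has difference 0.
  N-zero : ∀ i → N i 0g ≡ 0
  N-zero i = trans (N≡∑ i 0g)
    (∑ℕ-zero _ (λ a → ∑ℕ-zero _ (λ b → 𝟙-no (no-zero-difference a b) (pair? i 0g a b))))
    where
    no-zero-difference : ∀ a b → ¬ ((a ∈ A i) × (∃ λ j → (j ≢ i) × (b ∈ A j)) × (a ⊕ (⊖ b) ≡ 0g))
    no-zero-difference a b (a∈Ai , (j , j≢i , b∈Aj) , a-b≡0) =
      disjoint i j b (λ i≡j → j≢i (sym i≡j)) (subst (_∈ A i) (x∙y⁻¹≈ε⇒x≈y a b a-b≡0) a∈Ai) b∈Aj

  e-zero : e 0g ≡ 0ℚ
  e-zero = begin
    frac 1 (suc m′) ℚ.* sumℚ (λ i → frac (N i 0g) (k i))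
      ≡⟨ cong (frac 1 (suc m′) ℚ.*_) (sumℚ≡∑ℚ (λ i → frac (N i 0g) (k i))) ⟩
    frac 1 (suc m′) ℚ.* ∑ℚ (λ i → frac (N i 0g) (k i))
      ≡⟨ cong (frac 1 (suc m′) ℚ.*_) (ℚ∑.sum-cong-≗ no-pairs) ⟩
    frac 1 (suc m′) ℚ.* ∑ℚ {suc m′} (λ _ → 0ℚ)
      ≡⟨ cong (frac 1 (suc m′) ℚ.*_) (ℚ∑.sum-replicate-zero (suc m′)) ⟩
    frac 1 (suc m′) ℚ.* 0ℚ
      ≡⟨ ℚP.*-zeroʳ (frac 1 (suc m′)) ⟩
    0ℚ ∎
    where
    no-pairs : ∀ i → frac (N i 0g) (k i) ≡ 0ℚ
    no-pairs i = trans (cong (λ c → frac c (k i)) (N-zero i)) (frac-zero (k i))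

  e-total : 0 < n ∸ 1 → ∑ℚ e ≡ ι (n ∸ 1) ℚ.* Rbound
  e-total n-1>0 = begin
    ∑ℚ (λ δ → frac 1 (suc m′) ℚ.* sumℚ (λ i → F i δ))
      ≡⟨ ℚ∑.sum-cong-≗ (λ δ → cong (frac 1 (suc m′) ℚ.*_) (sumℚ≡∑ℚ (λ i → F i δ))) ⟩
    ∑ℚ (λ δ → frac 1 (suc m′) ℚ.* ∑ℚ (λ i → F i δ))
      ≡⟨ ℚ∑.*-distribˡ-sum (frac 1 (suc m′)) (λ δ → ∑ℚ (λ i → F i δ)) ⟨
    frac 1 (suc m′) ℚ.* ∑ℚ (λ δ → ∑ℚ (λ i → F i δ))
      ≡⟨ cong (frac 1 (suc m′) ℚ.*_) (ℚ∑.∑-comm (λ δ i → F i δ)) ⟩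
    frac 1 (suc m′) ℚ.* ∑ℚ (λ i → ∑ℚ (λ δ → F i δ))
      ≡⟨ cong (frac 1 (suc m′) ℚ.*_) (ℚ∑.sum-cong-≗ per-source) ⟩
    frac 1 (suc m′) ℚ.* ∑ℚ (λ i → ι (rest i))
      ≡⟨ cong (frac 1 (suc m′) ℚ.*_) (trans (sym (frac-∑ 1 rest)) (cong ι rest-total)) ⟩
    frac 1 (suc m′) ℚ.* ι (m′ * T)
      ≡⟨ frac-rescale {suc m′} (m′ * T) (s≤s z≤n) n-1>0 ⟩
    ι (n ∸ 1) ℚ.* Rbound ∎
    where
    F : Fin (suc m′) → Fin n → ℚ
    F i δ = frac (N i δ) (k i)
    per-source : ∀ i → ∑ℚ (F i) ≡ ι (rest i)
    per-source i = begin
      ∑ℚ (F i)                          ≡⟨ frac-∑ (k i) (N i) ⟨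
      frac (∑ℕ (N i)) (k i)             ≡⟨ cong (λ c → frac c (k i)) (N-total i) ⟩
      frac (k i * rest i) (k i)         ≡⟨ frac-cancel (rest i) (k-pos i) ⟩
      ι (rest i)                        ∎

mainTheorem1 : ∀ {n m : ℕ} (G : FinAbGroup n) (A : Fin m → Subset n)
    → 2 ≤ n → 1 ≤ m → IsWeakAMD A
    → AMD.ROptimal G A
      ⇔ (∀ δ δ′ → δ ≢ FinAbGroup.0g G → δ′ ≢ FinAbGroup.0g G → AMD.e G A δ ≡ AMD.e G A δ′)
mainTheorem1 G A (s≤s (s≤s _)) (s≤s _) weak =
  punctured-average e 0g Rbound e-zero (e-total (s≤s z≤n))
  where
  open FinAbGroup G using (0g)
  open AMD G A using (e; Rbound)
  open CodeCounting G A weak using (e-zero; e-total)
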